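{- Let $\phi:\Sigma^*\to\Gamma^*$ be an injective morphism and let $\mathcal{L}\subseteq\Sigma^*$. If $\phi$ is interference-free on $\mathcal{L}$, then $\phi$ is recognizable on $\mathcal{L}$.
   Context: A morphism $\phi:\Sigma^*\to\Gamma^*$ satisfies $\phi(uv)=\phi(u)\phi(v)$. Its set of images is $\mathrm{Im}(\phi)=\{\phi(c):c\in\Sigma\}$. $\phi$ is injective if $\phi(u)\neq\phi(v)$ for all $u\neq v\in\Sigma^*$. A word $w\in\Gamma^*$ admits an image factorization if $w=X_1\cdots X_n$ with each $X_i\in\mathrm{Im}(\phi)$ ($n\ge 0$). A word $w$ admits an interfered image factorization if $w=x\cdot y\cdot z$ where $x$ is a proper (possibly empty) suffix of some image, $y$ admits an image factorization, $z$ is a proper (possibly empty) prefix of some image, and $xz\neq\varepsilon$. A word $w$ is an inner image factor if $w$ is a proper factor of some image $\phi(c)$ but is neither a prefix nor a suffix of $\phi(c)$. For injective $\phi$ and $\mathcal{L}\subseteq\Sigma^*$, $\phi$ is interference-free on $\mathcal{L}$ if for every non-empty $u\in\mathcal{L}$, $\phi(u)$ does not admit an interfered image factorization and $\phi(u)$ is not an inner image factor. A rotation of $w$ is a word $w[i..|w|]\,w[1..i-1]$ for some $1\le i\le|w|$. A word $w$ admits a circular image factorization if $w=q\cdot r\cdot p$ where $r$ admits an image factorization, $pq=\phi(c)$ for some $c\in\Sigma$, and $p\neq\varepsilon$. An injective $\phi$ is recognizable on $\mathcal{L}$ if for every non-empty $u\in\mathcal{L}$ and every rotation $w'$ of $\phi(u)$,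 $w'$ admits a unique circular image factorization. -}

module Defs where

open import Data.Nat using (ℕ)
open import Data.Fin using (Fin)
open import Data.List using (List; []; _∷_; _++_; concatMap)
open import Data.Product using (Σ; ∃; ∃-syntax; _×_; _,_)
open import Relation.Binary.PropositionalEquality using (_≡_; _≢_)
open import Relation.Nullary using (¬_)
open import Level using (0ℓ; suc)

Morphism : ℕ → ℕ → Set
Morphism k m = Fin k → List (Fin m)

module _ {k m : ℕ} (φ : Morphism k m) where

  φ* : List (Fin k) → List (Fin m)
  φ* = concatMap φ

  Injective : Set
  Injective = ∀ u v → φ* u ≡ φ* v → u ≡ v

  ImageFactorization : List (Fin m) → Set
  ImageFactorization w = ∃[ cs ] w ≡ φ* cs

  ProperSuffixOfImage : List (Fin m) → Set
  ProperSuffixOfImage x = ∃[ c ] ∃[ p ] (p ≢ [] × p ++ x ≡ φ c)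

  ProperPrefixOfImage : List (Fin m) → Set
  ProperPrefixOfImage z = ∃[ c ] ∃[ s ] (s ≢ [] × z ++ s ≡ φ c)

  InterferedImageFactorization : List (Fin m) → Set
  InterferedImageFactorization w =
    ∃[ x ] ∃[ y ] ∃[ z ]
      ( w ≡ x ++ (y ++ z)
      × ProperSuffixOfImage x
      × ImageFactorization y
      × ProperPrefixOfImage z
      × x ++ z ≢ [] )

  InnerImageFactor : List (Fin m) → Set
  InnerImageFactor w =
    ∃[ c ] ( (∃[ a ] ∃[ b ] a ++ (w ++ b) ≡ φ c)
           × w ≢ φ c
           × ¬ (∃[ b ] w ++ b ≡ φ c)
           × ¬ (∃[ a ] a ++ w ≡ φ c) )

  InterferenceFree : (List (Fin k) → Set) → Set
  InterferenceFree L =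
    Injective ×
    (∀ u → L u → u ≢ [] →
       ¬ InterferedImageFactorization (φ* u) × ¬ InnerImageFactor (φ* u))

  -- w' is a rotation of w: w = w[1..i-1] w[i..|w|] with 1 ≤ i ≤ |w|,
  -- w' = w[i..|w|] w[1..i-1]; i.e. w = a ++ b, b nonempty, w' = b ++ a.
  Rotation : List (Fin m) → List (Fin m) → Set
  Rotation w w' = ∃[ a ] ∃[ b ] (b ≢ [] × w ≡ a ++ b × w' ≡ b ++ a)

  record CircularImageFactorization (w : List (Fin m)) : Set where
    constructor circ
    field
      q  : List (Fin m)
      cs : List (Fin k)
      p  : List (Fin m)
      c  : Fin k
      decomp : w ≡ q ++ (φ* cs ++ p)
      wrap   : p ++ q ≡ φ c
      p≢ε    : p ≢ []

  SameCircular : {w : List (Fin m)} → CircularImageFactorization w →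
                 CircularImageFactorization w → Set
  SameCircular f g =
    CircularImageFactorization.q f ≡ CircularImageFactorization.q g ×
    CircularImageFactorization.cs f ≡ CircularImageFactorization.cs g ×
    CircularImageFactorization.p f ≡ CircularImageFactorization.p g ×
    CircularImageFactorization.c f ≡ CircularImageFactorization.c g

  UniqueCircularImageFactorization : List (Fin m) → Set
  UniqueCircularImageFactorization w =
    CircularImageFactorization w ×
    (∀ (f g : CircularImageFactorization w) → SameCircular f g)

  Recognizable : (List (Fin k) → Set) → Set
  Recognizable L =
    Injective ×
    (∀ u → L u → u ≢ [] → ∀ w' → Rotation (φ* u) w' →
       UniqueCircularImageFactorization w')

-- Write W = φ(u).  Interference-freeness forces every occurrence of W inside a
-- factorised word φ(d) to be aligned with the factorisation: an occurrence
-- starting strictly inside an image φ(c) either lies within φ(c) (an inner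
-- image factor, or a proper prefix or suffix of an image) or has the shape
-- proper suffix · images · prefix, an interfered image factorisation.
-- A circular factorisation q · φ(cs) · p of the rotation b · a of W = a · b,
-- with p q = φ(c), puts W inside φ(c cs c cs c) = (p b)(a b)(a q); alignment of
-- this occurrence shows that the cut a | b of φ(u) falls inside the image of c,
-- after its prefix p.  Such a cut position is unique, and it determines the
-- circular factorisation.
module Submission where

open import Defs
open import Data.Nat using (ℕ; s≤s)
open import Data.Nat.Properties using (≤-trans; ≤-reflexive; 1+n≰n)
open import Data.Fin using (Fin)
open import Data.List using (List; []; _∷_; _++_; [_]; concat; map; length)
open import Data.List.Base using (initLast; _∷ʳ′_)
open import Data.List.Properties
  using (++-assoc; ++-identityʳ; ++-identityʳ-unique; ++-cancelˡ; ++-conicalˡ; ++-conicalʳ;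
         ∷-injective; concat-++; map-++; ++-monoid; length-++-≤ˡ; length-++-≤ʳ)
open import Data.Product using (Σ-syntax; ∃-syntax; _×_; _,_; proj₁)
open import Data.Sum using (_⊎_; inj₁; inj₂)
open import Data.Empty using (⊥; ⊥-elim)
open import Relation.Nullary using (¬_)
open import Relation.Binary.PropositionalEquality hiding ([_])
open import Tactic.MonoidSolver using (solve)

module _ {A : Set} where

  ++-split : (xs ys xs′ ys′ : List A) → xs ++ ys ≡ xs′ ++ ys′ →
    (∃[ g ] xs′ ≡ xs ++ g × ys ≡ g ++ ys′) ⊎
    (∃[ g ] g ≢ [] × xs ≡ xs′ ++ g × ys′ ≡ g ++ ys)
  ++-split []       ys xs′       ys′ e = inj₁ (xs′ , refl , e)
  ++-split (x ∷ xs) ys []        ys′ e = inj₂ (x ∷ xs , (λ ()) , refl , sym e)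
  ++-split (x ∷ xs) ys (x′ ∷ xs′) ys′ e with ∷-injective e
  ... | refl , e′ with ++-split xs ys xs′ ys′ e′
  ...   | inj₁ (g , xs′≡ , ys≡) = inj₁ (g , cong (x ∷_) xs′≡ , ys≡)
  ...   | inj₂ (g , g≢[] , xs≡ , ys′≡) = inj₂ (g , g≢[] , cong (x ∷_) xs≡ , ys′≡)

  ++-infix-≢ : (xs ys zs : List A) → xs ≢ [] → xs ++ (ys ++ zs) ≢ ys
  ++-infix-≢ []       ys zs xs≢[] _ = xs≢[] refl
  ++-infix-≢ (x ∷ xs) ys zs _     e = 1+n≰n (≤-trans
    (s≤s (≤-trans (length-++-≤ˡ ys) (length-++-≤ʳ (ys ++ zs) {xs})))
    (≤-reflexive (cong length e)))

  prefix-extension-empty : {x p q r : List A} → p ++ q ≡ x → p ≡ x ++ r → r ≡ []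
  prefix-extension-empty {x} {p} {q} {r} pq≡x refl = ++-conicalˡ r q
    (++-identityʳ-unique x (trans (sym pq≡x) (++-assoc x r q)))

module _ {k m : ℕ} (φ : Morphism k m) where

  private
    ⟦_⟧ : List (Fin k) → List (Fin m)
    ⟦ u ⟧ = φ* φ u

  φ*-++ : ∀ u v → ⟦ u ++ v ⟧ ≡ ⟦ u ⟧ ++ ⟦ v ⟧
  φ*-++ u v = trans (cong concat (map-++ φ u v)) (sym (concat-++ (map φ u) (map φ v)))

  data Cut (u : List (Fin k)) (s t : List (Fin m)) : Set where
    between : ∀ u₁ u₂ → u ≡ u₁ ++ u₂ → s ≡ ⟦ u₁ ⟧ → t ≡ ⟦ u₂ ⟧ → Cut u s t
    within  : ∀ u₁ c u₂ p q → u ≡ u₁ ++ c ∷ u₂ → s ≡ ⟦ u₁ ⟧ ++ p → t ≡ q ++ ⟦ u₂ ⟧ →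
              p ++ q ≡ φ c → p ≢ [] → q ≢ [] → Cut u s t

  cut : ∀ u s t → s ++ t ≡ ⟦ u ⟧ → Cut u s t
  cut []      s       t e = between [] [] refl (++-conicalˡ s t e) (++-conicalʳ s t e)
  cut (c ∷ u) []      t e = between [] (c ∷ u) refl refl e
  cut (c ∷ u) (x ∷ s) t e with ++-split (x ∷ s) t (φ c) ⟦ u ⟧ e
  ... | inj₁ ([] , φc≡ , t≡) =
    between [ c ] u refl
      (trans (sym (++-identityʳ (x ∷ s))) (trans (sym φc≡) (sym (++-identityʳ (φ c))))) t≡
  ... | inj₁ (g@(_ ∷ _) , φc≡ , t≡) = within [] c u (x ∷ s) g refl refl t≡ (sym φc≡) (λ ()) (λ ())
  ... | inj₂ (g , _ , s≡ , ⟦u⟧≡) with cut u g t (sym ⟦u⟧≡)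
  ...   | between u₁ u₂ refl refl t≡ = between (c ∷ u₁) u₂ refl s≡ t≡
  ...   | within u₁ c′ u₂ p q refl refl t≡ pq≡ p≢[] q≢[] =
    within (c ∷ u₁) c′ u₂ p q refl (trans s≡ (sym (++-assoc (φ c) ⟦ u₁ ⟧ p))) t≡ pq≡ p≢[] q≢[]

  -- p ≢ [] mirrors p ≠ ε in circular factorisations: a cut between two images
  -- is read at the right end of the left one.
  record LetterCut (u : List (Fin k)) (a b : List (Fin m)) : Set where
    field
      u₁ : List (Fin k)
      c  : Fin k
      u₂ : List (Fin k)
      p q : List (Fin m)
      u≡ : u ≡ u₁ ++ c ∷ u₂
      a≡ : a ≡ ⟦ u₁ ⟧ ++ p
      b≡ : b ≡ q ++ ⟦ u₂ ⟧
      pq≡ : p ++ q ≡ φ c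
      p≢[] : p ≢ []

  letterCut : (∀ c → φ c ≢ []) → ∀ u a b → a ++ b ≡ ⟦ u ⟧ → a ≢ [] → LetterCut u a b
  letterCut φ≢[] u a b e a≢[] with cut u a b e
  ... | within u₁ c u₂ p q u≡ a≡ b≡ pq≡ p≢[] _ = record
    { u₁ = u₁ ; c = c ; u₂ = u₂ ; p = p ; q = q
    ; u≡ = u≡ ; a≡ = a≡ ; b≡ = b≡ ; pq≡ = pq≡ ; p≢[] = p≢[] }
  ... | between u₁ u₂ u≡ a≡ b≡ with initLast u₁
  ...   | []      = ⊥-elim (a≢[] a≡)
  ...   | v ∷ʳ′ c = record
    { u₁ = v ; c = c ; u₂ = u₂ ; p = φ c ; q = []
    ; u≡ = trans u≡ (++-assoc v [ c ] u₂)
    ; a≡ = trans a≡ (trans (φ*-++ v [ c ]) (cong (⟦ v ⟧ ++_) (++-identityʳ (φ c))))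
    ; b≡ = b≡ ; pq≡ = ++-identityʳ (φ c) ; p≢[] = φ≢[] c }

  letter-position-unique : ∀ u₁ u₁′ {c c′ u₂ u₂′} {p p′ q q′ : List (Fin m)} →
    u₁ ++ c ∷ u₂ ≡ u₁′ ++ c′ ∷ u₂′ → ⟦ u₁ ⟧ ++ p ≡ ⟦ u₁′ ⟧ ++ p′ →
    p ++ q ≡ φ c → p′ ++ q′ ≡ φ c′ → p ≢ [] → p′ ≢ [] →
    u₁ ≡ u₁′ × c ≡ c′ × u₂ ≡ u₂′ × p ≡ p′ × q ≡ q′
  letter-position-unique [] [] {p = p} e refl pq≡ pq≡′ _ _ with ∷-injective e
  ... | refl , refl = refl , refl , refl , refl , ++-cancelˡ p _ _ (trans pq≡ (sym pq≡′))
  letter-position-unique [] (d ∷ v) {c} {p′ = p′} e ep pq≡ _ _ p′≢[] with ∷-injective e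
  ... | refl , _ = ⊥-elim (p′≢[] (++-conicalʳ ⟦ v ⟧ p′
        (prefix-extension-empty pq≡ (trans ep (++-assoc (φ c) ⟦ v ⟧ p′)))))
  letter-position-unique (d ∷ v) [] {c′ = c′} {p = p} e ep _ pq≡′ p≢[] _ with ∷-injective e
  ... | refl , _ = ⊥-elim (p≢[] (++-conicalʳ ⟦ v ⟧ p
        (prefix-extension-empty pq≡′ (trans (sym ep) (++-assoc (φ c′) ⟦ v ⟧ p)))))
  letter-position-unique (d ∷ v) (d′ ∷ v′) {p = p} {p′} e ep pq≡ pq≡′ p≢[] p′≢[] with ∷-injective e
  ... | refl , e′ with letter-position-unique v v′ e′
         (++-cancelˡ (φ d) _ _
           (trans (sym (++-assoc (φ d) ⟦ v ⟧ p)) (trans ep (++-assoc (φ d) ⟦ v′ ⟧ p′))))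
         pq≡ pq≡′ p≢[] p′≢[]
  ...   | refl , rest = refl , rest

  letterCut⇒circular : ∀ {u a b} → LetterCut u a b → CircularImageFactorization φ (b ++ a)
  letterCut⇒circular {a = a} {b} x = circ q (u₂ ++ u₁) p c decomp pq≡ p≢[]
    where
    open LetterCut x
    open ≡-Reasoning
    decomp : b ++ a ≡ q ++ (⟦ u₂ ++ u₁ ⟧ ++ p)
    decomp = begin
      b ++ a                          ≡⟨ cong₂ _++_ b≡ a≡ ⟩
      (q ++ ⟦ u₂ ⟧) ++ (⟦ u₁ ⟧ ++ p)   ≡⟨ solve (++-monoid (Fin m)) ⟩
      q ++ ((⟦ u₂ ⟧ ++ ⟦ u₁ ⟧) ++ p)   ≡⟨ cong (λ w → q ++ (w ++ p)) (sym (φ*-++ u₂ u₁)) ⟩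
      q ++ (⟦ u₂ ++ u₁ ⟧ ++ p)         ∎

  letterCut-unique : ∀ {u a b} (x y : LetterCut u a b) →
    SameCircular φ (letterCut⇒circular x) (letterCut⇒circular y)
  letterCut-unique x y with letter-position-unique (X.u₁) (Y.u₁)
    (trans (sym X.u≡) Y.u≡) (trans (sym X.a≡) Y.a≡) X.pq≡ Y.pq≡ X.p≢[] Y.p≢[]
    where module X = LetterCut x
          module Y = LetterCut y
  ... | u₁≡ , c≡ , u₂≡ , p≡ , q≡ = q≡ , cong₂ _++_ u₂≡ u₁≡ , p≡ , c≡

  three-turns : ∀ {c cs} {p q a b : List (Fin m)} → p ++ q ≡ φ c → b ++ a ≡ q ++ (⟦ cs ⟧ ++ p) →
    ⟦ c ∷ cs ++ c ∷ cs ++ [ c ] ⟧ ≡ (p ++ b) ++ ((a ++ b) ++ (a ++ q))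
  three-turns {c} {cs} {p} {q} {a} {b} pq≡ decomp = begin
    ⟦ c ∷ cs ++ c ∷ cs ++ [ c ] ⟧
      ≡⟨ cong (φ c ++_) (trans (φ*-++ cs _) (cong (λ w → ⟦ cs ⟧ ++ (φ c ++ w)) (φ*-++ cs [ c ]))) ⟩
    φ c ++ (⟦ cs ⟧ ++ (φ c ++ (⟦ cs ⟧ ++ (φ c ++ []))))
      ≡⟨ cong (λ w → w ++ (⟦ cs ⟧ ++ (w ++ (⟦ cs ⟧ ++ (w ++ []))))) (sym pq≡) ⟩
    (p ++ q) ++ (⟦ cs ⟧ ++ ((p ++ q) ++ (⟦ cs ⟧ ++ ((p ++ q) ++ []))))
      ≡⟨ solve (++-monoid (Fin m)) ⟩
    p ++ ((q ++ (⟦ cs ⟧ ++ p)) ++ ((q ++ (⟦ cs ⟧ ++ p)) ++ q))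
      ≡⟨ cong (λ w → p ++ (w ++ (w ++ q))) (sym decomp) ⟩
    p ++ ((b ++ a) ++ ((b ++ a) ++ q))
      ≡⟨ solve (++-monoid (Fin m)) ⟩
    (p ++ b) ++ ((a ++ b) ++ (a ++ q)) ∎
    where open ≡-Reasoning

  module _ (inj : Injective φ) where

    image-≢[] : ∀ c → φ c ≢ []
    image-≢[] c e with inj [ c ] [] (trans (++-identityʳ (φ c)) e)
    ... | ()

    φ*-≢[] : ∀ {u} → u ≢ [] → ⟦ u ⟧ ≢ []
    φ*-≢[] {u} u≢[] e = u≢[] (inj u [] e)

    aligned⇒letterCut : ∀ {u a b q cs p c} (decomp : b ++ a ≡ q ++ (⟦ cs ⟧ ++ p))
      (pq≡ : p ++ q ≡ φ c) (p≢[] : p ≢ []) e₁ d₂ →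
      a ++ b ≡ ⟦ u ⟧ → a ≢ [] → b ≡ q ++ ⟦ e₁ ⟧ → cs ++ c ∷ cs ++ [ c ] ≡ e₁ ++ (u ++ d₂) →
      Σ[ x ∈ LetterCut u a b ] SameCircular φ (circ q cs p c decomp pq≡ p≢[]) (letterCut⇒circular x)
    aligned⇒letterCut {u} {a} {b} {q} {cs} {p} {c} decomp pq≡ p≢[] e₁ d₂ ab≡ a≢[] b≡ e
      with ++-split e₁ (u ++ d₂) cs (c ∷ cs ++ [ c ]) (sym e)
    ... | inj₁ (g , refl , _) = x , refl , refl , refl , refl
      where
      open ≡-Reasoning
      a≡ : a ≡ ⟦ g ⟧ ++ p
      a≡ = ++-cancelˡ ⟦ e₁ ⟧ _ _ (begin
        ⟦ e₁ ⟧ ++ a             ≡⟨ e₁a≡ ⟩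
        ⟦ e₁ ++ g ⟧ ++ p         ≡⟨ cong (_++ p) (φ*-++ e₁ g) ⟩
        (⟦ e₁ ⟧ ++ ⟦ g ⟧) ++ p   ≡⟨ ++-assoc ⟦ e₁ ⟧ ⟦ g ⟧ p ⟩
        ⟦ e₁ ⟧ ++ (⟦ g ⟧ ++ p)  ∎)
        where
        e₁a≡ : ⟦ e₁ ⟧ ++ a ≡ ⟦ e₁ ++ g ⟧ ++ p
        e₁a≡ = ++-cancelˡ q _ _
          (trans (sym (++-assoc q ⟦ e₁ ⟧ a)) (trans (cong (_++ a) (sym b≡)) decomp))
      u≡ : u ≡ g ++ c ∷ e₁
      u≡ = inj u _ (begin
        ⟦ u ⟧                         ≡⟨ sym ab≡ ⟩
        a ++ b                        ≡⟨ cong₂ _++_ a≡ b≡ ⟩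
        (⟦ g ⟧ ++ p) ++ (q ++ ⟦ e₁ ⟧)  ≡⟨ solve (++-monoid (Fin m)) ⟩
        ⟦ g ⟧ ++ ((p ++ q) ++ ⟦ e₁ ⟧)  ≡⟨ cong (λ w → ⟦ g ⟧ ++ (w ++ ⟦ e₁ ⟧)) pq≡ ⟩
        ⟦ g ⟧ ++ ⟦ c ∷ e₁ ⟧            ≡⟨ sym (φ*-++ g (c ∷ e₁)) ⟩
        ⟦ g ++ c ∷ e₁ ⟧                ∎)
      x : LetterCut u a b
      x = record { u₁ = g ; c = c ; u₂ = e₁ ; p = p ; q = q
                 ; u≡ = u≡ ; a≡ = a≡ ; b≡ = b≡ ; pq≡ = pq≡ ; p≢[] = p≢[] }
    ... | inj₂ ([] , g≢[] , _ , _) = ⊥-elim (g≢[] refl)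
    ... | inj₂ (_ ∷ g , _ , refl , c∷≡) with ∷-injective c∷≡
    ...   | refl , _ = ⊥-elim (a≢[] (++-conicalʳ ⟦ g ⟧ a (prefix-extension-empty pq≡ p≡)))
      where
      open ≡-Reasoning
      p≡ : p ≡ φ c ++ (⟦ g ⟧ ++ a)
      p≡ = ++-cancelˡ (q ++ ⟦ cs ⟧) _ _ (begin
        (q ++ ⟦ cs ⟧) ++ p                      ≡⟨ solve (++-monoid (Fin m)) ⟩
        q ++ (⟦ cs ⟧ ++ p)                      ≡⟨ sym decomp ⟩
        b ++ a                                  ≡⟨ cong (_++ a) b≡ ⟩
        (q ++ ⟦ cs ++ c ∷ g ⟧) ++ a              ≡⟨ cong (λ w → (q ++ w) ++ a) (φ*-++ cs (c ∷ g)) ⟩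
        (q ++ (⟦ cs ⟧ ++ (φ c ++ ⟦ g ⟧))) ++ a   ≡⟨ solve (++-monoid (Fin m)) ⟩
        (q ++ ⟦ cs ⟧) ++ (φ c ++ (⟦ g ⟧ ++ a))  ∎)

    module _ (u₀ : Fin k) (u′ : List (Fin k))
             (no-interference : ¬ InterferedImageFactorization φ (φ* φ (u₀ ∷ u′)))
             (not-inner : ¬ InnerImageFactor φ (φ* φ (u₀ ∷ u′))) where

      private
        u : List (Fin k)
        u = u₀ ∷ u′
        W : List (Fin m)
        W = ⟦ u ⟧

        W≢[] : W ≢ []
        W≢[] = φ*-≢[] {u} (λ ())

      []-properSuffix : ProperSuffixOfImage φ []
      []-properSuffix = u₀ , φ u₀ , image-≢[] u₀ , ++-identityʳ (φ u₀)

      []-properPrefix : ProperPrefixOfImage φ []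
      []-properPrefix = u₀ , φ u₀ , image-≢[] u₀ , refl

      interference-ends-empty : ∀ {x z} e → W ≡ x ++ (⟦ e ⟧ ++ z) →
        ProperSuffixOfImage φ x → ProperPrefixOfImage φ z → x ++ z ≡ []
      interference-ends-empty {[]}    {[]}    _ _ _  _  = refl
      interference-ends-empty {[]}    {_ ∷ _} e W≡ sx pz =
        ⊥-elim (no-interference (_ , _ , _ , W≡ , sx , (e , refl) , pz , λ ()))
      interference-ends-empty {_ ∷ _} {z}     e W≡ sx pz =
        ⊥-elim (no-interference (_ , _ , z , W≡ , sx , (e , refl) , pz , λ ()))

      W-not-properSuffix : ¬ ProperSuffixOfImage φ W
      W-not-properSuffix sx = W≢[] (++-conicalˡ W []
        (interference-ends-empty [] (sym (++-identityʳ W)) sx []-properPrefix))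

      W-not-properPrefix : ¬ ProperPrefixOfImage φ W
      W-not-properPrefix pz = W≢[] (interference-ends-empty [] refl []-properSuffix pz)

      W-not-inside-image : ∀ {c} p h → p ++ (W ++ h) ≡ φ c → p ≢ [] → ⊥
      W-not-inside-image {c} p [] e p≢[] =
        W-not-properSuffix (c , p , p≢[] , trans (cong (p ++_) (sym (++-identityʳ W))) e)
      W-not-inside-image {c} p h@(_ ∷ _) e p≢[] =
        not-inner (c , (p , h , e) , W≢φc , not-prefix , not-suffix)
        where
        W≢φc : W ≢ φ c
        W≢φc W≡ = ++-infix-≢ p W h p≢[] (trans e (sym W≡))
        not-prefix : ¬ (∃[ s ] W ++ s ≡ φ c)
        not-prefix ([]    , e′) = W≢φc (trans (sym (++-identityʳ W)) e′)
        not-prefix (s@(_ ∷ _) , e′) = W-not-properPrefix (c , s , (λ ()) , e′)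
        not-suffix : ¬ (∃[ r ] r ++ W ≡ φ c)
        not-suffix ([]    , e′) = W≢φc e′
        not-suffix (r@(_ ∷ _) , e′) = W-not-properSuffix (c , r , (λ ()) , e′)

      aligned-occurrence : ∀ {x β} d → ProperSuffixOfImage φ x → W ++ β ≡ x ++ ⟦ d ⟧ →
        x ≡ [] × ∃[ d₂ ] d ≡ u ++ d₂
      aligned-occurrence {x} {β} d sx@(c , p , p≢[] , px≡) e with ++-split W β x ⟦ d ⟧ e
      ... | inj₁ (h , refl , _) = ⊥-elim (W-not-inside-image p h px≡ p≢[])
      ... | inj₂ (g , _ , W≡ , ⟦d⟧≡) with cut d g β (sym ⟦d⟧≡)
      ...   | within d₁ c′ d₂ p′ q′ _ refl _ pq≡ p′≢[] q′≢[] =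
        ⊥-elim (p′≢[] (++-conicalʳ x p′ (interference-ends-empty d₁ W≡ sx (c′ , q′ , q′≢[] , pq≡))))
      ...   | between d₁ d₂ refl refl _ with ++-conicalˡ x []
                (interference-ends-empty d₁ (trans W≡ (cong (x ++_) (sym (++-identityʳ ⟦ d₁ ⟧))))
                   sx []-properPrefix)
      ...     | refl = refl , d₂ , cong (_++ d₂) (sym (inj u d₁ W≡))

      synchronise : ∀ d α β → ⟦ d ⟧ ≡ α ++ (W ++ β) →
        ∃[ d₁ ] ∃[ d₂ ] d ≡ d₁ ++ (u ++ d₂) × ⟦ d₁ ⟧ ≡ α
      synchronise d α β e with cut d α (W ++ β) (sym e)
      ... | within d₁ c d₂ p q _ _ Wβ≡ pq≡ p≢[] q≢[] =
        ⊥-elim (q≢[] (proj₁ (aligned-occurrence d₂ (c , p , p≢[] , pq≡) Wβ≡)))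
      ... | between d₁ d₂ refl refl Wβ≡ with aligned-occurrence d₂ []-properSuffix Wβ≡
      ...   | _ , d₂′ , refl = d₁ , d₂′ , refl , refl

      circular⇒letterCut : ∀ a b → a ++ b ≡ W → a ≢ [] →
        (f : CircularImageFactorization φ (b ++ a)) →
        Σ[ x ∈ LetterCut u a b ] SameCircular φ f (letterCut⇒circular x)
      circular⇒letterCut a b ab≡ a≢[] (circ q cs p c decomp pq≡ p≢[])
        with synchronise (c ∷ cs ++ c ∷ cs ++ [ c ]) (p ++ b) (a ++ q)
               (trans (three-turns {c} {cs} {p} {q} {a} {b} pq≡ decomp)
                      (cong (λ w → (p ++ b) ++ (w ++ (a ++ q))) ab≡))
      ... | [] , _ , _ , ⟦d₁⟧≡ = ⊥-elim (p≢[] (++-conicalˡ p b (sym ⟦d₁⟧≡)))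
      ... | _ ∷ e₁ , d₂ , e , ⟦d₁⟧≡ with ∷-injective e
      ...   | refl , e′ = aligned⇒letterCut decomp pq≡ p≢[] e₁ d₂ ab≡ a≢[] b≡ e′
        where
        b≡ : b ≡ q ++ ⟦ e₁ ⟧
        b≡ = sym (++-cancelˡ p _ _
          (trans (sym (++-assoc p q ⟦ e₁ ⟧)) (trans (cong (_++ ⟦ e₁ ⟧) pq≡) ⟦d₁⟧≡)))

      unique-circular : ∀ a b → a ++ b ≡ W → a ≢ [] → UniqueCircularImageFactorization φ (b ++ a)
      unique-circular a b ab≡ a≢[] =
        letterCut⇒circular (letterCut image-≢[] u a b ab≡ a≢[]) , unique
        where
        unique : ∀ f g → SameCircular φ f g
        unique f g with circular⇒letterCut a b ab≡ a≢[] f | circular⇒letterCut a b ab≡ a≢[] g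
        ... | x , q≡ , cs≡ , p≡ , c≡ | y , q≡′ , cs≡′ , p≡′ , c≡′ with letterCut-unique x y
        ...   | q≡″ , cs≡″ , p≡″ , c≡″ =
          trans q≡ (trans q≡″ (sym q≡′)) , trans cs≡ (trans cs≡″ (sym cs≡′)) ,
          trans p≡ (trans p≡″ (sym p≡′)) , trans c≡ (trans c≡″ (sym c≡′))

rotation-left-≢[] : ∀ {k m} {φ : Morphism k m} {w w′} → w ≢ [] → Rotation φ w w′ →
  ∃[ a ] ∃[ b ] a ≢ [] × w ≡ a ++ b × w′ ≡ b ++ a
rotation-left-≢[] _ (a@(_ ∷ _) , b , _ , w≡ , w′≡) = a , b , (λ ()) , w≡ , w′≡
rotation-left-≢[] {w = w} w≢[] ([] , b , _ , refl , w′≡) =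
  w , [] , w≢[] , sym (++-identityʳ w) , trans w′≡ (++-identityʳ w)

theorem20 : (k m : ℕ) (φ : Morphism k m) (L : List (Fin k) → Set) →
    Injective φ → InterferenceFree φ L → Recognizable φ L
theorem20 k m φ L inj (_ , interference-free) = inj , recognizable
  where
  recognizable : ∀ u → L u → u ≢ [] → ∀ w′ → Rotation φ (φ* φ u) w′ →
    UniqueCircularImageFactorization φ w′
  recognizable [] _ u≢[] = ⊥-elim (u≢[] refl)
  recognizable (u₀ ∷ u′) Lu u≢[] w′ rot
    with interference-free (u₀ ∷ u′) Lu u≢[]
       | rotation-left-≢[] {φ = φ} (φ*-≢[] φ inj u≢[]) rot
  ... | no-interference , not-inner | a , b , a≢[] , W≡ , refl =
    unique-circular φ inj u₀ u′ no-interference not-inner a b (sym W≡) a≢[]
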